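{- Let $G$ be a group vertex magic graph, and suppose that for some (finite) Abelian group $\Gamma$, $G$ has a $\Gamma$-vertex magic labeling $\ell$ with magic constant $\mu$ such that $\sum_{v\in V(G)}\ell(v)=\mu$. Then $G$ is not a complete graph.
   Context: Graphs are finite, simple and undirected; in this part of the paper all Abelian groups are finite. For an additive Abelian group $\Gamma$ with identity $0$ and a graph $G$, a $\Gamma$-vertex magic labeling is a map $\ell:V(G)\to\Gamma\setminus\{0\}$ for which there is $\mu\in\Gamma$ (the magic constant) with $w(v)=\sum_{u\in N(v)}\ell(u)=\mu$ for every vertex $v$; $G$ is group vertex magic if it is $\Gamma$-vertex magic for every nontrivial Abelian group $\Gamma$. -}

module Defs where

open import Level using (0ℓ) renaming (suc to lsuc)
open import Data.Nat using (ℕ; zero; suc; _≤_)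
open import Data.Fin using (Fin)
open import Data.Bool using (Bool; true; false; if_then_else_)
open import Data.Product using (Σ; ∃; _×_; _,_)
open import Relation.Binary.PropositionalEquality using (_≡_; _≢_)
open import Relation.Nullary using (¬_)
open import Algebra.Bundles using (AbelianGroup)

record Graph : Set where
  field
    n      : ℕ
    adj    : Fin n → Fin n → Bool
    sym    : ∀ u v → adj u v ≡ adj v u
    irrefl : ∀ v → adj v v ≡ false

IsComplete : Graph → Set
IsComplete G = ∀ u v → u ≢ v → adj u v ≡ true
  where open Graph G

record FiniteAbelianGroup : Set₁ where
  field
    abGroup : AbelianGroup 0ℓ 0ℓ
  open AbelianGroup abGroup public
  field
    size : ℕ
    enum : Fin size → Carrier
    enum-surjective : ∀ x → ∃ λ i → enum i ≈ x

Nontrivial : FiniteAbelianGroup → Set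
Nontrivial Γ = ∃ λ x → ¬ (x ≈ ε)
  where open FiniteAbelianGroup Γ

module _ (Γ : FiniteAbelianGroup) where
  open FiniteAbelianGroup Γ

  sumFin : (m : ℕ) → (Fin m → Carrier) → Carrier
  sumFin zero    f = ε
  sumFin (suc m) f = f Fin.zero ∙ sumFin m (λ i → f (Fin.suc i))
    where import Data.Fin as Fin

  module _ (G : Graph) where
    open Graph G

    weight : (Fin n → Carrier) → Fin n → Carrier
    weight ℓ v = sumFin n (λ u → if adj v u then ℓ u else ε)

    IsVertexMagicLabeling : (Fin n → Carrier) → Carrier → Set
    IsVertexMagicLabeling ℓ μ =
      (∀ v → ¬ (ℓ v ≈ ε)) × (∀ v → weight ℓ v ≈ μ)

IsΓVertexMagic : FiniteAbelianGroup → Graph → Set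
IsΓVertexMagic Γ G =
  Σ (Fin (Graph.n G) → Carrier) λ ℓ → Σ Carrier λ μ → IsVertexMagicLabeling Γ G ℓ μ
  where open FiniteAbelianGroup Γ

IsGroupVertexMagic : Graph → Set₁
IsGroupVertexMagic G = ∀ (Γ : FiniteAbelianGroup) → Nontrivial Γ → IsΓVertexMagic Γ G

{-# OPTIONS --safe #-}
module Submission where

-- In a complete graph the neighbourhood of v is everything but v, so
-- w(v) + ℓ(v) = Σ ℓ = μ = w(v) and hence ℓ(v) = 0, contradicting that labels are nonzero.

open import Defs
open import Data.Nat using (_≤_; suc)
open import Data.Fin using (Fin; fromℕ<) renaming (zero to fz; suc to fs)
open import Data.Fin.Properties using (suc-injective)
open import Data.Bool using (if_then_else_)
open import Data.Product using (_,_)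
open import Relation.Nullary using (¬_)
open import Relation.Binary.PropositionalEquality as ≡ using (_≢_)
open import Algebra.Properties.Group using (identityʳ-unique)
import Relation.Binary.Reasoning.Setoid as SetoidReasoning

module _ (Γ : FiniteAbelianGroup) where
  open FiniteAbelianGroup Γ
  open SetoidReasoning setoid

  sumFin-cong : ∀ m {f g : Fin m → Carrier} → (∀ i → f i ≈ g i) →
                sumFin Γ m f ≈ sumFin Γ m g
  sumFin-cong 0       f≈g = refl
  sumFin-cong (suc m) f≈g = ∙-cong (f≈g fz) (sumFin-cong m (λ i → f≈g (fs i)))

  sumFin-restore : ∀ m (h l : Fin m → Carrier) (v : Fin m) →
                   (∀ u → u ≢ v → h u ≈ l u) → h v ≈ ε →
                   sumFin Γ m h ∙ l v ≈ sumFin Γ m l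
  sumFin-restore (suc m) h l fz h≈l hv≈ε = begin
    (h fz ∙ sumFin Γ m (λ i → h (fs i))) ∙ l fz
      ≈⟨ ∙-cong (∙-cong hv≈ε (sumFin-cong m (λ i → h≈l (fs i) (λ ())))) refl ⟩
    (ε ∙ sumFin Γ m (λ i → l (fs i))) ∙ l fz
      ≈⟨ ∙-cong (identityˡ _) refl ⟩
    sumFin Γ m (λ i → l (fs i)) ∙ l fz
      ≈⟨ comm _ _ ⟩
    l fz ∙ sumFin Γ m (λ i → l (fs i)) ∎
  sumFin-restore (suc m) h l (fs v) h≈l hv≈ε = begin
    (h fz ∙ sumFin Γ m (λ i → h (fs i))) ∙ l (fs v)
      ≈⟨ assoc _ _ _ ⟩
    h fz ∙ (sumFin Γ m (λ i → h (fs i)) ∙ l (fs v))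
      ≈⟨ ∙-cong (h≈l fz (λ ()))
                (sumFin-restore m (λ i → h (fs i)) (λ i → l (fs i)) v
                   (λ u u≢v → h≈l (fs u) (λ eq → u≢v (suc-injective eq))) hv≈ε) ⟩
    l fz ∙ sumFin Γ m (λ i → l (fs i)) ∎

  weight∙label-complete : (G : Graph) → IsComplete G →
                          (ℓ : Fin (Graph.n G) → Carrier) (v : Fin (Graph.n G)) →
                          weight Γ G ℓ v ∙ ℓ v ≈ sumFin Γ (Graph.n G) ℓ
  weight∙label-complete G complete ℓ v =
    sumFin-restore n (λ u → if adj v u then ℓ u else ε) ℓ v neighbour non-neighbour
    where
      open Graph G using (n; adj; irrefl)
      neighbour : ∀ u → u ≢ v → (if adj v u then ℓ u else ε) ≈ ℓ u
      neighbour u u≢v rewrite complete v u (λ eq → u≢v (≡.sym eq)) = refl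
      non-neighbour : (if adj v v then ℓ v else ε) ≈ ε
      non-neighbour rewrite irrefl v = refl

theorem2p1 : (G : Graph) → 1 ≤ Graph.n G → IsGroupVertexMagic G →
    (Γ : FiniteAbelianGroup) →
    (ℓ : Fin (Graph.n G) → FiniteAbelianGroup.Carrier Γ) →
    (μ : FiniteAbelianGroup.Carrier Γ) →
    IsVertexMagicLabeling Γ G ℓ μ →
    FiniteAbelianGroup._≈_ Γ (sumFin Γ (Graph.n G) ℓ) μ →
    ¬ IsComplete G
theorem2p1 G 1≤n _ Γ ℓ μ (nonzero , magic) Σℓ≈μ complete =
  nonzero v (identityʳ-unique group μ (ℓ v) μ∙ℓv≈μ)
  where
    open FiniteAbelianGroup Γ
    open SetoidReasoning setoid
    v : Fin (Graph.n G)
    v = fromℕ< 1≤n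
    μ∙ℓv≈μ : μ ∙ ℓ v ≈ μ
    μ∙ℓv≈μ = begin
      μ ∙ ℓ v                ≈⟨ ∙-cong (sym (magic v)) refl ⟩
      weight Γ G ℓ v ∙ ℓ v   ≈⟨ weight∙label-complete Γ G complete ℓ v ⟩
      sumFin Γ (Graph.n G) ℓ ≈⟨ Σℓ≈μ ⟩
      μ                      ∎
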